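{- Let $G$ be the infinite triangular grid, i.e. the graph with vertex set $\mathbb{Z}^2$ in which $(a,b)$ is adjacent exactly to $(a\pm1,b)$, $(a,b\pm1)$, $(a+1,b-1)$ and $(a-1,b+1)$. Then $\overrightarrow{\beta}(G,1)\le 6$ (the maximum degree of $G$).
   Context: Firefighting on oriented graphs: an orientation $\overrightarrow{G}$ of a simple graph $G$ replaces each edge $uv$ by exactly one of the arcs $\overrightarrow{uv}$, $\overrightarrow{vu}$. Let $f\ge 1$ be an integer. A fire breaks out at a vertex $v$ at time $1$ ($v$ burns). At the end of each time unit, the firefighters permanently protect up to $f$ vertices that are neither burning nor already protected. At the next time unit, every vertex that is neither burning nor protected and is an out-neighbour of a burning vertex starts to burn. The process ends when no new vertex can burn (the number of burnt vertices may be infinite for infinite graphs). $\beta(\overrightarrow{G},f)$ is the supremum, over all starting vertices $v$, of the infimum, over all protection strategies, of the number of vertices that burn. $\overrightarrow{\beta}(G,f)$ is the infimum of $\beta(\overrightarrow{G},f)$ over all orientations $\overrightarrow{G}$ of $G$. -}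

module Defs where

open import Level using (0ℓ)
open import Data.Nat using (ℕ; zero; suc; _≤_; _<_)
open import Data.Integer using (ℤ; +_; _+_; -[1+_])
open import Data.Product using (_×_; _,_; Σ; ∃; ∃-syntax)
open import Data.Sum using (_⊎_)
open import Data.List using (List; length)
open import Data.List.Membership.Propositional using (_∈_)
open import Relation.Nullary using (¬_)
open import Relation.Binary.PropositionalEquality using (_≡_)

record Orientation {V : Set} (Adj : V → V → Set) : Set₁ where
  field
    Arc       : V → V → Set
    arc⇒adj   : ∀ {u v} → Arc u v → Adj u v
    adj⇒arc   : ∀ {u v} → Adj u v → Arc u v ⊎ Arc v u
    antisym   : ∀ {u v} → Arc u v → ¬ Arc v u

-- Time is shifted by one: index n ∈ ℕ stands for time unit n+1.
-- A strategy s gives, for each n, the list s n of vertices protected at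
-- the end of time unit n+1.

module Fire {V : Set} (Arc : V → V → Set) (start : V) (s : ℕ → List V) where

  Protected : ℕ → V → Set
  Protected n w = ∃[ i ] (i ≤ n × w ∈ s i)

  data Burns : ℕ → V → Set where
    ignite : Burns zero start
    stay   : ∀ {n w} → Burns n w → Burns (suc n) w
    spread : ∀ {n u w} → Burns n u → Arc u w → ¬ Protected n w →
             Burns (suc n) w

  Burnt : V → Set
  Burnt w = ∃[ n ] Burns n w

  Valid : ℕ → Set
  Valid f = ∀ n → length (s n) ≤ f ×
            (∀ w → w ∈ s n → ¬ Burns n w × (∀ i → i < n → ¬ w ∈ s i))

AtMost : {V : Set} → ℕ → (V → Set) → Set
AtMost {V} k P = Σ (List V) λ L → length L ≤ k × (∀ w → P w → w ∈ L)

BetaLe : {V : Set} → (V → V → Set) → ℕ → ℕ → Set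
BetaLe {V} Arc f k =
  ∀ (v : V) → Σ (ℕ → List V) λ s →
    Fire.Valid Arc v s f × AtMost k (Fire.Burnt Arc v s)

OrientedBetaLe : {V : Set} → (V → V → Set) → ℕ → ℕ → Set₁
OrientedBetaLe Adj f k = Σ (Orientation Adj) λ O → BetaLe (Orientation.Arc O) f k

-1ℤ : ℤ
-1ℤ = -[1+ 0 ]

data TriAdj : ℤ × ℤ → ℤ × ℤ → Set where
  e+0 : ∀ {a b} → TriAdj (a , b) (a + + 1 , b)
  e-0 : ∀ {a b} → TriAdj (a , b) (a + -1ℤ , b)
  e0+ : ∀ {a b} → TriAdj (a , b) (a , b + + 1)
  e0- : ∀ {a b} → TriAdj (a , b) (a , b + -1ℤ)
  e+- : ∀ {a b} → TriAdj (a , b) (a + + 1 , b + -1ℤ)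
  e-+ : ∀ {a b} → TriAdj (a , b) (a + -1ℤ , b + + 1)

-- Colour (a , b) by a - b mod 3; this is a proper 3-colouring and a
-- group homomorphism ℤ² → ℤ₃.  Orient every edge at a vertex of colour 2
-- towards it (colour 2 becomes a set of sinks) and orient the hexagonal
-- lattice formed by colours 0 and 1 so that each colour-0 vertex has a
-- single out-neighbour of colour 1.  A fire started at colour 2 stops at
-- once; at colour 0 the firefighter protects that out-neighbour and only
-- 4 vertices burn; at colour 1 two protections leave 6 burnt vertices.

module Submission where

open import Defs

open import Data.Bool using (Bool; true; false; T; not)
open import Data.Bool.Properties using (T-≡; T?)
open import Data.Empty using (⊥-elim)
open import Data.Integer using (ℤ; +_; -[1+_]; +[1+_]; _+_; _-_; 1ℤ)
import Data.Integer.Properties as ℤ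
open import Data.Integer.Properties using (+-assoc; +-identityʳ; +-0-abelianGroup)
open import Data.Integer.Tactic.RingSolver using (solve-∀)
open import Algebra.Properties.AbelianGroup +-0-abelianGroup using (∙-cancelˡ)
open import Data.List using (List; []; _∷_; _++_; concat; map; length)
open import Data.List.Properties using (length-map)
open import Data.List.Membership.Propositional using (_∈_; _∉_)
open import Data.List.Membership.Propositional.Properties
  using (∈-++⁻; ∈-++⁺ʳ; ∈-map⁺; ∈-map⁻)
open import Data.List.Relation.Binary.Subset.Propositional using (_⊆_)
open import Data.List.Relation.Binary.Subset.Propositional.Properties
  using (xs⊆xs++ys; ++⁺ʳ; map⁺)
open import Data.List.Relation.Unary.All using (All; all?)
import Data.List.Relation.Unary.All as All
open import Data.List.Relation.Unary.Any using (here; there)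
open import Data.Nat using (ℕ; zero; suc; _≤_; _<_; z≤n; s≤s)
import Data.Nat.Properties as ℕ
open import Data.Product using (_×_; _,_; Σ; ∃-syntax; proj₁; proj₂)
open import Data.Product.Properties using (≡-dec)
open import Data.Sum using (_⊎_; inj₁; inj₂)
open import Function.Base using (_∘_)
open import Function.Bundles using (Equivalence)
open import Relation.Binary.Definitions using (DecidableEquality)
open import Relation.Binary.PropositionalEquality
  using (_≡_; refl; sym; trans; cong; cong₂; subst; module ≡-Reasoning)
open import Relation.Nullary using (¬_; Dec; ¬?; _×-dec_; _⊎-dec_; _→-dec_)
open import Relation.Nullary.Decidable using (True; toWitness; from-yes; map′)

data ℤ₃ : Set where
  0₃ 1₃ 2₃ : ℤ₃

suc₃ : ℤ₃ → ℤ₃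
suc₃ 0₃ = 1₃
suc₃ 1₃ = 2₃
suc₃ 2₃ = 0₃

pred₃ : ℤ₃ → ℤ₃
pred₃ 0₃ = 2₃
pred₃ 1₃ = 0₃
pred₃ 2₃ = 1₃

infixl 6 _+₃_
_+₃_ : ℤ₃ → ℤ₃ → ℤ₃
a +₃ 0₃ = a
a +₃ 1₃ = suc₃ a
a +₃ 2₃ = pred₃ a

suc₃-+₃ : ∀ a b → suc₃ (a +₃ b) ≡ a +₃ suc₃ b
suc₃-+₃ 0₃ 0₃ = refl
suc₃-+₃ 0₃ 1₃ = refl
suc₃-+₃ 0₃ 2₃ = refl
suc₃-+₃ 1₃ 0₃ = refl
suc₃-+₃ 1₃ 1₃ = refl
suc₃-+₃ 1₃ 2₃ = refl
suc₃-+₃ 2₃ 0₃ = refl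
suc₃-+₃ 2₃ 1₃ = refl
suc₃-+₃ 2₃ 2₃ = refl

pred₃-+₃ : ∀ a b → pred₃ (a +₃ b) ≡ a +₃ pred₃ b
pred₃-+₃ 0₃ 0₃ = refl
pred₃-+₃ 0₃ 1₃ = refl
pred₃-+₃ 0₃ 2₃ = refl
pred₃-+₃ 1₃ 0₃ = refl
pred₃-+₃ 1₃ 1₃ = refl
pred₃-+₃ 1₃ 2₃ = refl
pred₃-+₃ 2₃ 0₃ = refl
pred₃-+₃ 2₃ 1₃ = refl
pred₃-+₃ 2₃ 2₃ = refl

residue : ℤ → ℤ₃
residue (+ 0)          = 0₃
residue +[1+ n ]       = suc₃ (residue (+ n))
residue -[1+ 0 ]       = 2₃
residue -[1+ suc n ]   = pred₃ (residue -[1+ n ])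

residue-suc : ∀ z → residue (z + 1ℤ) ≡ suc₃ (residue z)
residue-suc (+ n) rewrite ℕ.+-comm n 1 = refl
residue-suc -[1+ 0 ]     = refl
residue-suc -[1+ suc n ] = sym (suc₃-+₃ (residue -[1+ n ]) 2₃)

residue-pred : ∀ z → residue (z + -1ℤ) ≡ pred₃ (residue z)
residue-pred (+ 0)       = refl
residue-pred +[1+ n ]    = sym (pred₃-+₃ (residue (+ n)) 1₃)
residue-pred -[1+ n ] rewrite ℕ.+-identityʳ n = refl

residue-+ : ∀ z w → residue (z + w) ≡ residue z +₃ residue w
residue-+ z (+ 0) = cong residue (+-identityʳ z)
residue-+ z +[1+ n ] = begin
  residue (z + +[1+ n ])           ≡⟨ cong (λ m → residue (z + + m)) (ℕ.+-comm 1 n) ⟩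
  residue (z + (+ n + 1ℤ))         ≡⟨ cong residue (sym (+-assoc z (+ n) 1ℤ)) ⟩
  residue (z + + n + 1ℤ)           ≡⟨ residue-suc (z + + n) ⟩
  suc₃ (residue (z + + n))         ≡⟨ cong suc₃ (residue-+ z (+ n)) ⟩
  suc₃ (residue z +₃ residue (+ n)) ≡⟨ suc₃-+₃ (residue z) (residue (+ n)) ⟩
  residue z +₃ residue +[1+ n ]    ∎
  where open ≡-Reasoning
residue-+ z -[1+ 0 ] = residue-pred z
residue-+ z -[1+ suc n ] = begin
  residue (z + -[1+ suc n ])          ≡⟨ cong (λ m → residue (z + -[1+ suc m ])) (sym (ℕ.+-identityʳ n)) ⟩
  residue (z + (-[1+ n ] + -1ℤ))      ≡⟨ cong residue (sym (+-assoc z -[1+ n ] -1ℤ)) ⟩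
  residue (z + -[1+ n ] + -1ℤ)        ≡⟨ residue-pred (z + -[1+ n ]) ⟩
  pred₃ (residue (z + -[1+ n ]))      ≡⟨ cong pred₃ (residue-+ z -[1+ n ]) ⟩
  pred₃ (residue z +₃ residue -[1+ n ]) ≡⟨ pred₃-+₃ (residue z) (residue -[1+ n ]) ⟩
  residue z +₃ residue -[1+ suc n ]   ∎
  where open ≡-Reasoning

Point : Set
Point = ℤ × ℤ

origin : Point
origin = (+ 0 , + 0)

infixl 6 _⊞_
_⊞_ : Point → Point → Point
(a , b) ⊞ (x , y) = (a + x , b + y)

⊞-identityʳ : ∀ u → u ⊞ origin ≡ u
⊞-identityʳ (a , b) = cong₂ _,_ (+-identityʳ a) (+-identityʳ b)

⊞-assoc : ∀ u o p → u ⊞ o ⊞ p ≡ u ⊞ (o ⊞ p)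
⊞-assoc (a , b) (x , y) (x′ , y′) = cong₂ _,_ (+-assoc a x x′) (+-assoc b y y′)

⊞-cancelˡ : ∀ u {o p} → u ⊞ o ≡ u ⊞ p → o ≡ p
⊞-cancelˡ (a , b) eq =
  cong₂ _,_ (∙-cancelˡ a _ _ (cong proj₁ eq)) (∙-cancelˡ b _ _ (cong proj₂ eq))

data Direction : Set where
  east west north south southEast northWest : Direction

opposite : Direction → Direction
opposite east      = west
opposite west      = east
opposite north     = south
opposite south     = north
opposite southEast = northWest
opposite northWest = southEast

step : Direction → Point → Point
step east      (a , b) = (a + + 1 , b)
step west      (a , b) = (a + -1ℤ , b)
step north     (a , b) = (a , b + + 1)
step south     (a , b) = (a , b + -1ℤ)
step southEast (a , b) = (a + + 1 , b + -1ℤ)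
step northWest (a , b) = (a + -1ℤ , b + + 1)

vec : Direction → Point
vec d = step d origin

step-⊞ : ∀ d u → step d u ≡ u ⊞ vec d
step-⊞ east      (a , b) = cong (a + + 1 ,_) (sym (+-identityʳ b))
step-⊞ west      (a , b) = cong (a + -1ℤ ,_) (sym (+-identityʳ b))
step-⊞ north     (a , b) = cong (_, b + + 1) (sym (+-identityʳ a))
step-⊞ south     (a , b) = cong (_, b + -1ℤ) (sym (+-identityʳ a))
step-⊞ southEast (a , b) = refl
step-⊞ northWest (a , b) = refl

step-translate : ∀ d u o → step d (u ⊞ o) ≡ u ⊞ step d o
step-translate d u o = begin
  step d (u ⊞ o)   ≡⟨ step-⊞ d (u ⊞ o) ⟩
  u ⊞ o ⊞ vec d    ≡⟨ ⊞-assoc u o (vec d) ⟩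
  u ⊞ (o ⊞ vec d)  ≡⟨ cong (u ⊞_) (sym (step-⊞ d o)) ⟩
  u ⊞ step d o     ∎
  where open ≡-Reasoning

vec-opposite : ∀ d → vec d ⊞ vec (opposite d) ≡ origin
vec-opposite east      = refl
vec-opposite west      = refl
vec-opposite north     = refl
vec-opposite south     = refl
vec-opposite southEast = refl
vec-opposite northWest = refl

step-opposite : ∀ d u → step (opposite d) (step d u) ≡ u
step-opposite d u = begin
  step (opposite d) (step d u)      ≡⟨ cong (step (opposite d)) (step-⊞ d u) ⟩
  step (opposite d) (u ⊞ vec d)     ≡⟨ step-translate (opposite d) u (vec d) ⟩
  u ⊞ step (opposite d) (vec d)     ≡⟨ cong (u ⊞_) (step-⊞ (opposite d) (vec d)) ⟩
  u ⊞ (vec d ⊞ vec (opposite d))    ≡⟨ cong (u ⊞_) (vec-opposite d) ⟩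
  u ⊞ origin                        ≡⟨ ⊞-identityʳ u ⟩
  u                                 ∎
  where open ≡-Reasoning

directionOf : Point → Direction
directionOf (+ 1 , + 0)         = east
directionOf (-[1+ 0 ] , + 0)    = west
directionOf (+ 0 , + 1)         = north
directionOf (+ 0 , -[1+ 0 ])    = south
directionOf (+ 1 , -[1+ 0 ])    = southEast
directionOf _                   = northWest

directionOf-vec : ∀ d → directionOf (vec d) ≡ d
directionOf-vec east      = refl
directionOf-vec west      = refl
directionOf-vec north     = refl
directionOf-vec south     = refl
directionOf-vec southEast = refl
directionOf-vec northWest = refl

step-injective : ∀ d e u → step d u ≡ step e u → d ≡ e
step-injective d e u eq = begin
  d                     ≡⟨ sym (directionOf-vec d) ⟩
  directionOf (vec d)   ≡⟨ cong directionOf (⊞-cancelˡ u same-translate) ⟩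
  directionOf (vec e)   ≡⟨ directionOf-vec e ⟩
  e                     ∎
  where
  open ≡-Reasoning
  same-translate : u ⊞ vec d ≡ u ⊞ vec e
  same-translate = trans (sym (step-⊞ d u)) (trans eq (step-⊞ e u))

step-adjacent : ∀ d u → TriAdj u (step d u)
step-adjacent east      _ = e+0
step-adjacent west      _ = e-0
step-adjacent north     _ = e0+
step-adjacent south     _ = e0-
step-adjacent southEast _ = e+-
step-adjacent northWest _ = e-+

adjacent-step : ∀ {u v} → TriAdj u v → Σ Direction λ d → v ≡ step d u
adjacent-step e+0 = east , refl
adjacent-step e-0 = west , refl
adjacent-step e0+ = north , refl
adjacent-step e0- = south , refl
adjacent-step e+- = southEast , refl
adjacent-step e-+ = northWest , refl

colour : Point → ℤ₃
colour (a , b) = residue (a - b)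

colour-⊞ : ∀ u o → colour (u ⊞ o) ≡ colour u +₃ colour o
colour-⊞ (a , b) (x , y) = begin
  residue ((a + x) - (b + y))     ≡⟨ cong residue (interchange a b x y) ⟩
  residue ((a - b) + (x - y))     ≡⟨ residue-+ (a - b) (x - y) ⟩
  residue (a - b) +₃ residue (x - y) ∎
  where
  open ≡-Reasoning
  interchange : ∀ a b x y → (a + x) - (b + y) ≡ (a - b) + (x - y)
  interchange = solve-∀

colour-step : ∀ d u → colour (step d u) ≡ colour u +₃ colour (vec d)
colour-step d u = trans (cong colour (step-⊞ d u)) (colour-⊞ u (vec d))

-- The orientation: 'outward c d' says that the edge from a vertex of
-- colour c in direction d points away from it.  Colour 2 is a sink; the
-- edges between colours 0 and 1 form a hexagonal lattice in which each
-- vertex of colour 0 has a single out-arc (eastwards).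

outward : ℤ₃ → Direction → Bool
outward 0₃ east      = true
outward 0₃ west      = true
outward 0₃ north     = true
outward 0₃ south     = false
outward 0₃ southEast = true
outward 0₃ northWest = false
outward 1₃ west      = false
outward 1₃ _         = true
outward 2₃ _         = false

-- Every edge is oriented in exactly one direction: seen from the other
-- endpoint, an edge is outward iff it is not outward from the first one.
outward-opposite : ∀ c d → outward (c +₃ colour (vec d)) (opposite d) ≡ not (outward c d)
outward-opposite 0₃ east      = refl
outward-opposite 0₃ west      = refl
outward-opposite 0₃ north     = refl
outward-opposite 0₃ south     = refl
outward-opposite 0₃ southEast = refl
outward-opposite 0₃ northWest = refl
outward-opposite 1₃ east      = refl
outward-opposite 1₃ west      = refl
outward-opposite 1₃ north     = refl
outward-opposite 1₃ south     = refl
outward-opposite 1₃ southEast = refl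
outward-opposite 1₃ northWest = refl
outward-opposite 2₃ east      = refl
outward-opposite 2₃ west      = refl
outward-opposite 2₃ north     = refl
outward-opposite 2₃ south     = refl
outward-opposite 2₃ southEast = refl
outward-opposite 2₃ northWest = refl

Arc : Point → Point → Set
Arc u w = Σ Direction λ d → T (outward (colour u) d) × w ≡ step d u

outward-back : ∀ d u → outward (colour (step d u)) (opposite d) ≡ not (outward (colour u) d)
outward-back d u =
  trans (cong (λ c → outward c (opposite d)) (colour-step d u)) (outward-opposite (colour u) d)

orient-edge : ∀ d u → Arc u (step d u) ⊎ Arc (step d u) u
orient-edge d u with outward (colour u) d in out
... | true  = inj₁ (d , Equivalence.from T-≡ out , refl)
... | false = inj₂ (opposite d , back , sym (step-opposite d u))
  where
  back : T (outward (colour (step d u)) (opposite d))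
  back = Equivalence.from T-≡ (trans (outward-back d u) (cong not out))

arc-antisym : ∀ {u v} → Arc u v → ¬ Arc v u
arc-antisym {u} (d , out , refl) (e , back , u≡) =
  subst T (trans (outward-back d u) (cong not (Equivalence.to T-≡ out))) back′
  where
  e≡ : e ≡ opposite d
  e≡ = step-injective e (opposite d) (step d u) (trans (sym u≡) (sym (step-opposite d u)))
  back′ : T (outward (colour (step d u)) (opposite d))
  back′ = subst (λ e → T (outward (colour (step d u)) e)) e≡ back

adjacent-arc : ∀ {u v} → TriAdj u v → Arc u v ⊎ Arc v u
adjacent-arc {u} adj with adjacent-step adj
... | d , refl = orient-edge d u

orientation : Orientation TriAdj
orientation = record
  { Arc     = Arc
  ; arc⇒adj = λ { {u} (d , _ , refl) → step-adjacent d u }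
  ; adj⇒arc = adjacent-arc
  ; antisym = arc-antisym
  }

module _ {V : Set} (Arc : V → V → Set) (start : V) (s : ℕ → List V) where
  open Fire Arc start s

  burning-within : (R : ℕ → V → Set) → R 0 start → (∀ {n w} → R n w → R (suc n) w) →
                   (∀ {n u w} → R n u → Arc u w → R (suc n) w ⊎ Protected n w) →
                   ∀ {n w} → Burns n w → R n w
  burning-within R start∈R monotone closed = within
    where
    within : ∀ {n w} → Burns n w → R n w
    within ignite                 = start∈R
    within (stay b)               = monotone (within b)
    within (spread b arc unprotected) with closed (within b) arc
    ... | inj₁ w∈R       = w∈R
    ... | inj₂ protected = ⊥-elim (unprotected protected)

-- Schedules: a list of stages, the i-th stage holding what is added at
-- time i (nothing is added after the last stage).

module _ {A : Set} where

  stage : List (List A) → ℕ → List A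
  stage []       _       = []
  stage (x ∷ _)  zero    = x
  stage (_ ∷ xs) (suc i) = stage xs i

  accumulated : List (List A) → ℕ → List A
  accumulated []       _       = []
  accumulated (x ∷ _)  zero    = x
  accumulated (x ∷ xs) (suc n) = x ++ accumulated xs n

  earlier : List (List A) → ℕ → List A
  earlier _ zero    = []
  earlier L (suc n) = accumulated L n

  accumulated-mono : ∀ L n → accumulated L n ⊆ accumulated L (suc n)
  accumulated-mono []       _       = λ ()
  accumulated-mono (x ∷ xs) zero    = xs⊆xs++ys x (accumulated xs 0)
  accumulated-mono (x ∷ xs) (suc n) = ++⁺ʳ x (accumulated-mono xs n)

  accumulated-⊆-concat : ∀ L n → accumulated L n ⊆ concat L
  accumulated-⊆-concat []       _       = λ ()
  accumulated-⊆-concat (x ∷ xs) zero    = xs⊆xs++ys x (concat xs)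
  accumulated-⊆-concat (x ∷ xs) (suc n) = ++⁺ʳ x (accumulated-⊆-concat xs n)

  accumulated-stage : ∀ L n {a} → a ∈ accumulated L n → ∃[ i ] (i ≤ n × a ∈ stage L i)
  accumulated-stage (x ∷ xs) zero    a∈ = 0 , z≤n , a∈
  accumulated-stage (x ∷ xs) (suc n) a∈ with ∈-++⁻ x a∈
  ... | inj₁ a∈x  = 0 , z≤n , a∈x
  ... | inj₂ a∈xs = let (i , i≤n , a∈i) = accumulated-stage xs n a∈xs in suc i , s≤s i≤n , a∈i

  stage-earlier : ∀ L {i n} → i < n → stage L i ⊆ earlier L n
  stage-earlier L (s≤s i≤n) = stage-accumulated L i≤n
    where
    stage-accumulated : ∀ L {i n} → i ≤ n → stage L i ⊆ accumulated L n
    stage-accumulated []       _                         = λ ()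
    stage-accumulated (x ∷ xs) {zero}  {zero}  _         = λ a∈ → a∈
    stage-accumulated (x ∷ xs) {zero}  {suc n} _         = xs⊆xs++ys x (accumulated xs n)
    stage-accumulated (x ∷ xs) {suc i} {suc n} (s≤s i≤n) = ∈-++⁺ʳ x ∘ stage-accumulated xs i≤n

-- Certificates in coordinates relative to the start vertex.  Since
-- colour (v ⊞ o) = colour v +₃ colour o, the process started at v only
-- depends on k = colour v, and a finite check on offsets o suffices.

allDirections : List Direction
allDirections = east ∷ west ∷ north ∷ south ∷ southEast ∷ northWest ∷ []

direction∈ : ∀ d → d ∈ allDirections
direction∈ east      = here refl
direction∈ west      = there (here refl)
direction∈ north     = there (there (here refl))
direction∈ south     = there (there (there (here refl)))
direction∈ southEast = there (there (there (there (here refl))))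
direction∈ northWest = there (there (there (there (there (here refl)))))

_≟ₚ_ : DecidableEquality Point
_≟ₚ_ = ≡-dec ℤ._≟_ ℤ._≟_

open import Data.List.Membership.DecPropositional _≟ₚ_ using (_∈?_)

-- B lists the offsets that start burning, P the offsets protected, stage
-- by stage.
Closed : ℤ₃ → (B P : List (List Point)) → ℕ → Set
Closed k B P n = All (λ o → All (λ d → T (outward (k +₃ colour o) d) →
                                      step d o ∈ accumulated B (suc n) ⊎ step d o ∈ accumulated P n)
                                allDirections)
                     (accumulated B n)

Legal : ℕ → (B P : List (List Point)) → ℕ → Set
Legal f B P n = length (stage P n) ≤ f ×
                All (λ o → o ∉ accumulated B n × o ∉ earlier P n) (stage P n)

closed? : ∀ k B P n → Dec (Closed k B P n)
closed? k B P n =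
  all? (λ o → all? (λ d → T? (outward (k +₃ colour o) d) →-dec
                            (step d o ∈? accumulated B (suc n) ⊎-dec step d o ∈? accumulated P n))
                   allDirections)
       (accumulated B n)

legal? : ∀ f B P n → Dec (Legal f B P n)
legal? f B P n =
  length (stage P n) ℕ.≤? f ×-dec
  all? (λ o → ¬? (o ∈? accumulated B n) ×-dec ¬? (o ∈? earlier P n)) (stage P n)

record Certified (f : ℕ) (k : ℤ₃) (B P : List (List Point)) (n : ℕ) : Set where
  constructor certified-at
  field
    closed : Closed k B P n
    legal  : Legal f B P n

certified? : ∀ f k B P n → Dec (Certified f k B P n)
certified? f k B P n =
  map′ (λ (c , l) → certified-at c l) (λ (certified-at c l) → c , l)
       (closed? k B P n ×-dec legal? f B P n)

-- Past the
-- last stage of the schedules the conditions no longer depend on n, so a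
-- certificate splits n only up to the length of its burning schedule.
certify : ∀ {f k B P} n → {True (certified? f k B P n)} → Certified f k B P n
certify n {ok} = toWitness ok

record Containment (f m : ℕ) (k : ℤ₃) : Set where
  field
    burning   : List (List Point)
    plan      : List (List Point)
    ignites   : origin ∈ accumulated burning 0
    certified : ∀ n → Certified f k burning plan n
    bounded   : length (concat burning) ≤ m

∈-translate⁻ : ∀ v {o L} → v ⊞ o ∈ map (v ⊞_) L → o ∈ L
∈-translate⁻ v {L = L} v⊞o∈ with ∈-map⁻ (v ⊞_) v⊞o∈
... | o′ , o′∈L , eq = subst (_∈ L) (sym (⊞-cancelˡ v eq)) o′∈L

module Contain {f m : ℕ} (v : Point) (cert : Containment f m (colour v)) where
  open Containment cert

  strategy : ℕ → List Point
  strategy n = map (v ⊞_) (stage plan n)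

  open Fire Arc v strategy

  Region : ℕ → Point → Set
  Region n w = w ∈ map (v ⊞_) (accumulated burning n)

  translate∈ : ∀ d o {L} → step d o ∈ L → step d (v ⊞ o) ∈ map (v ⊞_) L
  translate∈ d o {L} = subst (_∈ map (v ⊞_) L) (sym (step-translate d v o)) ∘ ∈-map⁺ (v ⊞_)

  region-closed : ∀ {n u w} → Region n u → Arc u w → Region (suc n) w ⊎ Protected n w
  region-closed {n} u∈ (d , out , refl) with ∈-map⁻ (v ⊞_) u∈
  ... | o , o∈ , refl
      with All.lookup (All.lookup (Certified.closed (certified n)) o∈) (direction∈ d)
                      (subst (λ c → T (outward c d)) (colour-⊞ v o) out)
  ... | inj₁ next = inj₁ (translate∈ d o next)
  ... | inj₂ prot = let (i , i≤n , o∈i) = accumulated-stage plan n prot in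
                    inj₂ (i , i≤n , translate∈ d o o∈i)

  burns-in-region : ∀ {n w} → Burns n w → Region n w
  burns-in-region = burning-within Arc v strategy Region
    (subst (Region 0) (⊞-identityʳ v) (∈-map⁺ (v ⊞_) ignites))
    (λ {n} → map⁺ (v ⊞_) (accumulated-mono burning n))
    region-closed

  valid : Valid f
  valid n = subst (_≤ f) (sym (length-map (v ⊞_) (stage plan n)))
                  (proj₁ (Certified.legal (certified n))) ,
            fresh
    where
    fresh : ∀ w → w ∈ strategy n → ¬ Burns n w × (∀ i → i < n → ¬ w ∈ strategy i)
    fresh w w∈ with ∈-map⁻ (v ⊞_) w∈
    ... | o , o∈ , refl with All.lookup (proj₂ (Certified.legal (certified n))) o∈
    ... | not-burning , not-earlier =
      (λ b → not-burning (∈-translate⁻ v (burns-in-region b))) ,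
      (λ i i<n w∈i → not-earlier (stage-earlier plan i<n (∈-translate⁻ v w∈i)))

  few-burnt : AtMost m Burnt
  few-burnt = map (v ⊞_) (concat burning) ,
              subst (_≤ m) (sym (length-map (v ⊞_) (concat burning))) bounded ,
              λ { w (n , b) → map⁺ (v ⊞_) (accumulated-⊆-concat burning n) (burns-in-region b) }

contain : ∀ {f m} v → Containment f m (colour v) →
          Σ (ℕ → List Point) λ s → Fire.Valid Arc v s f × AtMost m (Fire.Burnt Arc v s)
contain v cert = strategy , valid , few-burnt
  where open Contain v cert

-- A start of colour 2 is a sink: nothing spreads.
sink-containment : Containment 1 6 2₃
sink-containment = record
  { burning   = burning
  ; plan      = []
  ; ignites   = here refl
  ; certified = λ { 0 → certify 0 ; (suc n) → certify (suc n) }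
  ; bounded   = from-yes (length (concat burning) ℕ.≤? 6)
  }
  where
  burning : List (List Point)
  burning = (origin ∷ []) ∷ []

-- From colour 0 the only out-neighbour of colour 1 is east; protecting it
-- leaves three neighbours of colour 2 (sinks) to burn: 4 vertices.
colour0-containment : Containment 1 6 0₃
colour0-containment = record
  { burning   = burning
  ; plan      = plan
  ; ignites   = here refl
  ; certified = λ { 0 → certify 0 ; 1 → certify 1 ; (suc (suc n)) → certify (suc (suc n)) }
  ; bounded   = from-yes (length (concat burning) ℕ.≤? 6)
  }
  where
  burning plan : List (List Point)
  burning = (origin ∷ []) ∷ (vec west ∷ vec north ∷ vec southEast ∷ []) ∷ []
  plan    = (vec east ∷ []) ∷ []

-- From colour 1, protect the northern colour-0 neighbour; the south-eastern
-- one burns next and its only colour-1 out-neighbour is protected in turn.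
-- Burnt: the start, its three colour-2 out-neighbours, the south-eastern
-- neighbour and one further sink: 6 vertices.
colour1-containment : Containment 1 6 1₃
colour1-containment = record
  { burning   = burning
  ; plan      = plan
  ; ignites   = here refl
  ; certified = λ { 0 → certify 0 ; 1 → certify 1 ; 2 → certify 2
                  ; (suc (suc (suc n))) → certify (suc (suc (suc n))) }
  ; bounded   = from-yes (length (concat burning) ℕ.≤? 6)
  }
  where
  burning plan : List (List Point)
  burning = (origin ∷ [])
          ∷ (vec east ∷ vec south ∷ vec northWest ∷ vec southEast ∷ [])
          ∷ (step southEast (vec southEast) ∷ [])
          ∷ []
  plan    = (vec north ∷ []) ∷ (step east (vec southEast) ∷ []) ∷ []

containment : ∀ k → Containment 1 6 k
containment 0₃ = colour0-containment
containment 1₃ = colour1-containment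
containment 2₃ = sink-containment

proposition5p15 : OrientedBetaLe TriAdj 1 6
proposition5p15 = orientation , λ v → contain v (containment (colour v))
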